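{- Let $f:[n]\to\mathbb{R}$ be injective and let $G$ be a connected graph on vertex set $[n]$. Let $u,v$ be two vertices of $G$ and suppose that the distance $uv$ is not reconstructible from $G$. Then there exists a connected partition $S_1\cup\dots\cup S_k$ of $[n]$ which is a witness with respect to $G$ and $f$, and such that $u\in S_1$ and $v\in S_2$.
   Context: For injective $f:[n]\to\mathbb{R}$, a graph $G$ on $[n]$ and vertices $u,v$, the distance $uv$ is not reconstructible from $G$ if there is an injective $g:[n]\to\mathbb{R}$ with $|g(x)-g(y)|=|f(x)-f(y)|$ for every edge $xy\in E(G)$ but $|f(u)-f(v)|\ne|g(u)-g(v)|$. A partition $S_1\cup\dots\cup S_k$ of $V(G)$ is a connected partition if each $G[S_i]$ is connected. A connected partition $S_1\cup\dots\cup S_k$ of $[n]$ is a witness with respect to $G$ and $f$ if there exist reals $f_{ij}$ ($i,j\in[k]$) with $f_{\ell\ell}=0$ for all $\ell$ such that: (a) the set $W$ of edges of $G$ with endpoints in two different parts satisfies $|W|\le|E(G)|/2$; (b) for all $a_i\in S_i$, $a_j\in S_j$ with $i\ne j$ and $a_ia_j\in E(G)$, we have $f(a_i)-f(a_j)=f_{ij}$; (c) for every cycle $C=x_1\dots x_r$ with $x_r=x_1$ in $G$, where $x_i\in S_{y_i}$ for each $i\in[r]$, we have $f_{y_1y_2}+\dots+f_{y_{r-1}y_r}=0$. -}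

module Defs where

open import Level using (Level; 0ℓ) renaming (suc to lsuc)
open import Data.Nat using (ℕ; zero; suc; _+_; _*_; _≤_; _<ᵇ_)
open import Data.Bool using (Bool; true; false; _∧_; not; if_then_else_)
open import Data.Fin using (Fin; toℕ; zero; suc; _≟_)
open import Data.List using (List; []; _∷_; _++_; [_]; length; concatMap; map)
open import Data.List.Relation.Unary.Linked using (Linked)
open import Data.List.Relation.Unary.Unique.Propositional using (Unique)
open import Data.Product using (Σ; ∃; _×_; _,_)
open import Data.Unit using (⊤)
open import Data.Sum using (_⊎_)
open import Relation.Nullary using (¬_)
open import Relation.Nullary.Decidable using (⌊_⌋)
open import Relation.Binary.PropositionalEquality using (_≡_)
open import Relation.Binary.Structures using (IsStrictTotalOrder)
open import Relation.Binary.Definitions using (tri<; tri≈; tri>)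
open import Algebra.Structures using (IsCommutativeRing)
open import Function.Definitions using (Injective)

-- The real numbers, given axiomatically as a complete ordered field
-- (any two models are isomorphic, so quantifying over all models is
-- the same as speaking about ℝ).

record RealField : Set₁ where
  infixl 6 _+ᴿ_ _-ᴿ_
  infixl 7 _*ᴿ_
  infix 4 _<ᴿ_ _≤ᴿ_
  field
    R     : Set
    _+ᴿ_  : R → R → R
    _*ᴿ_  : R → R → R
    -ᴿ_   : R → R
    0ᴿ    : R
    1ᴿ    : R
    _<ᴿ_  : R → R → Set
    isCommutativeRing : IsCommutativeRing _≡_ _+ᴿ_ _*ᴿ_ -ᴿ_ 0ᴿ 1ᴿ
    0≢1       : ¬ (0ᴿ ≡ 1ᴿ)
    inverse   : ∀ x → ¬ (x ≡ 0ᴿ) → Σ R λ y → x *ᴿ y ≡ 1ᴿ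
    isStrictTotalOrder : IsStrictTotalOrder _≡_ _<ᴿ_
    +-mono-<  : ∀ x y z → x <ᴿ y → x +ᴿ z <ᴿ y +ᴿ z
    *-pos     : ∀ x y → 0ᴿ <ᴿ x → 0ᴿ <ᴿ y → 0ᴿ <ᴿ x *ᴿ y
  _-ᴿ_ : R → R → R
  x -ᴿ y = x +ᴿ (-ᴿ y)
  _≤ᴿ_ : R → R → Set
  x ≤ᴿ y = (x <ᴿ y) ⊎ (x ≡ y)
  field
    complete : (P : R → Set) → (∃ λ x → P x) → (∃ λ b → ∀ x → P x → x ≤ᴿ b) →
               ∃ λ s → (∀ x → P x → x ≤ᴿ s) × (∀ b → (∀ x → P x → x ≤ᴿ b) → s ≤ᴿ b)

  ∣_∣ᴿ : R → R
  ∣ x ∣ᴿ with IsStrictTotalOrder.compare isStrictTotalOrder x 0ᴿ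
  ... | tri< _ _ _ = -ᴿ x
  ... | tri≈ _ _ _ = x
  ... | tri> _ _ _ = x


record Graph (n : ℕ) : Set where
  field
    Adj     : Fin n → Fin n → Bool
    sym     : ∀ x y → Adj x y ≡ Adj y x
    irrefl  : ∀ x → Adj x x ≡ false

open Graph public

Edge : ∀ {n} → Graph n → Fin n → Fin n → Set
Edge G x y = Adj G x y ≡ true

-- Walks in G all of whose vertices satisfy S (walks in the induced subgraph G[S])
data WalkIn {n} (G : Graph n) (S : Fin n → Set) : Fin n → Fin n → Set where
  [_]ʷ : ∀ {x} → S x → WalkIn G S x x
  _∷ʷ_ : ∀ {x y z} → (S x × Edge G x y) → WalkIn G S y z → WalkIn G S x z

Connected : ∀ {n} → Graph n → Set
Connected G = ∀ x y → WalkIn G (λ _ → ⊤) x y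

InducedConnected : ∀ {n} → Graph n → (Fin n → Set) → Set
InducedConnected G S = ∀ x y → S x → S y → WalkIn G S x y

count : ∀ {A : Set} → (A → Bool) → List A → ℕ
count p []       = 0
count p (a ∷ as) = if p a then suc (count p as) else count p as

allFinL : ∀ n → List (Fin n)
allFinL zero    = []
allFinL (suc n) = zero ∷ map suc (allFinL n)

allPairs : ∀ n → List (Fin n × Fin n)
allPairs n = concatMap (λ x → map (λ y → (x , y)) (allFinL n)) (allFinL n)

numEdges : ∀ {n} → Graph n → ℕ
numEdges {n} G = count (λ { (x , y) → (toℕ x <ᵇ toℕ y) ∧ Adj G x y }) (allPairs n)

numCrossEdges : ∀ {n k} → Graph n → (Fin n → Fin k) → ℕ
numCrossEdges {n} G part =
  count (λ { (x , y) → (toℕ x <ᵇ toℕ y) ∧ Adj G x y ∧ not ⌊ part x ≟ part y ⌋ }) (allPairs n)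

-- Cycles: a cycle x₁ … x_{r-1} x_r = x₁ is given by the list
-- x₁ ∷ … ∷ x_{r-1} of distinct vertices (at least 3), consecutive
-- ones adjacent and x_{r-1} adjacent to x₁.

closeUp : ∀ {n} → List (Fin n) → List (Fin n)
closeUp []       = []
closeUp (x ∷ xs) = (x ∷ xs) ++ [ x ]

IsCycle : ∀ {n} → Graph n → List (Fin n) → Set
IsCycle G xs = Unique xs × 3 ≤ length xs × Linked (Edge G) (closeUp xs)

consecSum : ∀ {A : Set} (ℝ : RealField) → (A → A → RealField.R ℝ) → List A → RealField.R ℝ
consecSum ℝ h []           = RealField.0ᴿ ℝ
consecSum ℝ h (x ∷ [])     = RealField.0ᴿ ℝ
consecSum ℝ h (x ∷ y ∷ xs) = RealField._+ᴿ_ ℝ (h x y) (consecSum ℝ h (y ∷ xs))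

NotReconstructible : (ℝ : RealField) → ∀ {n} → Graph n →
                     (Fin n → RealField.R ℝ) → Fin n → Fin n → Set
NotReconstructible ℝ {n} G f u v =
  Σ (Fin n → R) λ g → Injective _≡_ _≡_ g ×
    (∀ x y → Edge G x y → ∣ g x -ᴿ g y ∣ᴿ ≡ ∣ f x -ᴿ f y ∣ᴿ) ×
    ¬ (∣ f u -ᴿ f v ∣ᴿ ≡ ∣ g u -ᴿ g v ∣ᴿ)
  where open RealField ℝ

-- Connected partitions S_1 ∪ … ∪ S_k, given by part : Fin n → Fin k
-- with S_i = part⁻¹(i); parts are nonempty.

IsConnectedPartition : ∀ {n k} → Graph n → (Fin n → Fin k) → Set
IsConnectedPartition {n} {k} G part =
  (∀ (i : Fin k) → ∃ λ x → part x ≡ i) ×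
  (∀ (i : Fin k) → InducedConnected G (λ x → part x ≡ i))

IsWitness : (ℝ : RealField) → ∀ {n k} → Graph n → (Fin n → RealField.R ℝ) →
            (Fin n → Fin k) → Set
IsWitness ℝ {n} {k} G f part =
  IsConnectedPartition G part ×
  Σ (Fin k → Fin k → R) λ F →
    (∀ l → F l l ≡ 0ᴿ) ×
    (2 * numCrossEdges G part ≤ numEdges G) ×
    (∀ a b → ¬ (part a ≡ part b) → Edge G a b → f a -ᴿ f b ≡ F (part a) (part b)) ×
    (∀ xs → IsCycle G xs → consecSum ℝ (λ a b → F (part a) (part b)) (closeUp xs) ≡ 0ᴿ)
  where open RealField ℝ

{-# OPTIONS --safe #-}

-- Let g realise every edge length |f x − f y| of G but not |f u − f v|, and
-- put φ = (f − g)/2.  On an edge xy either g x − g y = f x − f y, and then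
-- φ x = φ y, or g x − g y = −(f x − f y), and then f x − f y = φ x − φ y.
-- Replacing g by −g exchanges the two cases, so for one of the two signs φ is
-- non-constant on at most half of the edges.  The parts are the components of
-- the graph of edges on which φ is constant: u and v lie in different parts
-- because φ u ≠ φ v, every edge between parts satisfies f a − f b = φ a − φ b,
-- so F i j := φ(S_i) − φ(S_j) gives (b), and (c) holds since F is a difference
-- of potentials.

module Submission where

open import Defs hiding (sym; irrefl)
open import Level using (0ℓ)
open import Algebra.Bundles using (CommutativeRing)
open import Data.Bool using (Bool; true; false; T; _∧_; not; if_then_else_) renaming (_≟_ to _≟ᴮ_)
open import Data.Bool.Properties using (∧-assoc)
open import Data.Empty using (⊥; ⊥-elim)
open import Data.Fin using (Fin; zero; suc; toℕ; _≟_)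
open import Data.Fin.Permutation using (Permutation′; _⟨$⟩ʳ_; _⟨$⟩ˡ_; inverseʳ; transpose; _∘ₚ_)
import Data.Fin.Permutation.Components as PC
open import Data.Fin.Properties using (¬Fin0; any?; suc-injective)
open import Data.List using ([]; _∷_; _++_; [_])
open import Data.Nat using (ℕ; zero; suc; _+_; _*_; _≤_; _<ᵇ_; z≤n; s≤s)
open import Data.Nat.Properties as ℕₚ
  using (+-suc; ≤-trans; ≤-reflexive; ≤-total; m≤n⇒m≤1+n; +-monoʳ-≤; *-monoʳ-≤; module ≤-Reasoning)
open import Data.Product using (Σ; ∃; _×_; _,_; proj₁; proj₂)
open import Data.Sum as Sum using (_⊎_; inj₁; inj₂)
open import Data.Unit using (⊤; tt)
import Data.Vec.Functional as Vector
open import Function using (_∘_; _on_; Injection)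
open import Function.Definitions using (Injective)
open import Function.Properties.Inverse using (↔⇒↣)
open import Relation.Binary using (Rel; Symmetric; Decidable; IsEquivalence; IsDecEquivalence)
import Relation.Binary.Construct.On as On
open import Relation.Binary.Construct.Closure.ReflexiveTransitive using (Star; ε; _◅_; _◅◅_; gmap; reverse; return)
open import Relation.Binary.PropositionalEquality hiding ([_])
open import Relation.Binary.Structures using (IsStrictTotalOrder)
open import Relation.Binary.Definitions using (tri<; tri≈; tri>)
open import Relation.Nullary using (¬_; Dec; yes; no)
open import Relation.Nullary.Decidable
  using (⌊_⌋; _×-dec_; _⊎-dec_; map′; dec-true; dec-false; toWitnessFalse; fromWitnessFalse)

-- A walk either avoids the vertex zero, or both of its ends reach zero by
-- walks that meet zero only at their end; both alternatives are decided by
-- reachability among the remaining vertices.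
module Reachability {n} {H : Rel (Fin (suc n)) 0ℓ} (sym-H : Symmetric H) (H? : Decidable H)
                    (star⁺? : Decidable (Star (H on suc))) where

  H⁺ : Rel (Fin n) 0ℓ
  H⁺ = H on suc

  lift : ∀ {a b} → Star H⁺ a b → Star H (suc a) (suc b)
  lift = gmap suc (λ h → h)

  ReachesZero : Fin (suc n) → Set
  ReachesZero zero    = ⊤
  ReachesZero (suc a) = ∃ λ b → Star H⁺ a b × H (suc b) zero

  AvoidsZero : Fin (suc n) → Fin (suc n) → Set
  AvoidsZero (suc a) (suc b) = Star H⁺ a b
  AvoidsZero _       _       = ⊥

  Connects : Fin (suc n) → Fin (suc n) → Set
  Connects p q = AvoidsZero p q ⊎ (ReachesZero p × ReachesZero q)

  reachesZero⇒star : ∀ {p} → ReachesZero p → Star H p zero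
  reachesZero⇒star {zero}  _                = ε
  reachesZero⇒star {suc a} (b , a⇝b , b~0) = lift a⇝b ◅◅ return b~0

  connects⇒star : ∀ {p q} → Connects p q → Star H p q
  connects⇒star {suc a} {suc b} (inj₁ a⇝b)         = lift a⇝b
  connects⇒star                 (inj₂ (p⇝0 , q⇝0)) =
    reachesZero⇒star p⇝0 ◅◅ reverse sym-H (reachesZero⇒star q⇝0)

  reachesZero-step : ∀ {p p′} → H p p′ → ReachesZero p′ → ReachesZero p
  reachesZero-step {zero}                 _   _                  = tt
  reachesZero-step {suc a} {zero}   a~0 _                  = a , ε , a~0
  reachesZero-step {suc a} {suc a′} a~a′ (b , a′⇝b , b~0) = b , a~a′ ◅ a′⇝b , b~0

  connects-step : ∀ {p p′ q} → H p p′ → Connects p′ q → Connects p q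
  connects-step p~p′ (inj₂ (p′⇝0 , q⇝0)) = inj₂ (reachesZero-step p~p′ p′⇝0 , q⇝0)
  connects-step {zero}  {suc a′} {suc b} 0~a′ (inj₁ a′⇝b) =
    inj₂ (tt , a′ , reverse sym-H a′⇝b , sym-H 0~a′)
  connects-step {suc a} {suc a′} {suc b} a~a′ (inj₁ a′⇝b) = inj₁ (a~a′ ◅ a′⇝b)

  star⇒connects : ∀ {p q} → Star H p q → Connects p q
  star⇒connects {zero}  ε             = inj₂ (tt , tt)
  star⇒connects {suc a} ε             = inj₁ ε
  star⇒connects         (p~p′ ◅ p′⇝q) = connects-step p~p′ (star⇒connects p′⇝q)

  reachesZero? : ∀ p → Dec (ReachesZero p)
  reachesZero? zero    = yes tt
  reachesZero? (suc a) = any? (λ b → star⁺? a b ×-dec H? (suc b) zero)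

  avoidsZero? : ∀ p q → Dec (AvoidsZero p q)
  avoidsZero? zero    _       = no λ ()
  avoidsZero? (suc a) zero    = no λ ()
  avoidsZero? (suc a) (suc b) = star⁺? a b

  star? : Decidable (Star H)
  star? p q = map′ connects⇒star star⇒connects (avoidsZero? p q ⊎-dec (reachesZero? p ×-dec reachesZero? q))

star-decidable : ∀ {n} {H : Rel (Fin n) 0ℓ} → Symmetric H → Decidable H → Decidable (Star H)
star-decidable {zero}  _     _  ()
star-decidable {suc n} sym-H H? = Reachability.star? sym-H H? (star-decidable sym-H (λ x y → H? (suc x) (suc y)))

star⇒walkIn : ∀ {n} {G : Graph n} {H : Rel (Fin n) 0ℓ} {S : Fin n → Set} →
              (∀ {x y} → H x y → Edge G x y) → (∀ {x y} → H x y → S x → S y) →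
              ∀ {x y} → Star H x y → S x → WalkIn G S x y
star⇒walkIn H⊆G S-closed ε           Sx = [ Sx ]ʷ
star⇒walkIn H⊆G S-closed (x~y ◅ y⇝z) Sx =
  (Sx , H⊆G x~y) ∷ʷ star⇒walkIn H⊆G S-closed y⇝z (S-closed x~y Sx)

record IsClassLabelling {n k ℓ} (_∼_ : Rel (Fin n) ℓ) (label : Fin n → Fin k) : Set ℓ where
  field
    surjective : ∀ i → ∃ λ x → label x ≡ i
    sound      : ∀ {x y} → label x ≡ label y → x ∼ y
    complete   : ∀ {x y} → x ∼ y → label x ≡ label y

open IsClassLabelling

module ExtendLabelling {n k ℓ} {_∼_ : Rel (Fin (suc n)) ℓ} (isEquivalence : IsEquivalence _∼_)
                       {label : Fin n → Fin k} (isLabelling : IsClassLabelling (_∼_ on suc) label) where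
  open IsEquivalence isEquivalence renaming (refl to ∼-refl; sym to ∼-sym; trans to ∼-trans)
  private module L = IsClassLabelling isLabelling

  joinClass : ∀ {y} → zero ∼ suc y → IsClassLabelling _∼_ (label y Vector.∷ label)
  joinClass _   .surjective i = let x , lx≡i = L.surjective i in suc x , lx≡i
  joinClass _   .sound {zero}  {zero}   _      = ∼-refl
  joinClass 0∼y .sound {zero}  {suc x}  ly≡lx  = ∼-trans 0∼y (L.sound ly≡lx)
  joinClass 0∼y .sound {suc x} {zero}   lx≡ly  = ∼-trans (L.sound lx≡ly) (∼-sym 0∼y)
  joinClass _   .sound {suc x} {suc x′} lx≡lx′ = L.sound lx≡lx′
  joinClass _   .complete {zero}  {zero}   _     = refl
  joinClass 0∼y .complete {zero}  {suc x}  0∼x   = L.complete (∼-trans (∼-sym 0∼y) 0∼x)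
  joinClass 0∼y .complete {suc x} {zero}   x∼0   = L.complete (∼-trans x∼0 0∼y)
  joinClass _   .complete {suc x} {suc x′} x∼x′  = L.complete x∼x′

  newClass : (∀ y → ¬ zero ∼ suc y) → IsClassLabelling _∼_ (zero Vector.∷ λ x → suc (label x))
  newClass _   .surjective zero    = zero , refl
  newClass _   .surjective (suc i) = let x , lx≡i = L.surjective i in suc x , cong suc lx≡i
  newClass _   .sound {zero}  {zero}   _      = ∼-refl
  newClass _   .sound {suc x} {suc x′} lx≡lx′ = L.sound (suc-injective lx≡lx′)
  newClass _   .complete {zero}  {zero}   _    = refl
  newClass 0≁  .complete {zero}  {suc x}  0∼x  = ⊥-elim (0≁ x 0∼x)
  newClass 0≁  .complete {suc x} {zero}   x∼0  = ⊥-elim (0≁ x (∼-sym x∼0))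
  newClass _   .complete {suc x} {suc x′} x∼x′ = cong suc (L.complete x∼x′)

classLabelling : ∀ {n ℓ} {_∼_ : Rel (Fin n) ℓ} → IsDecEquivalence _∼_ →
                 Σ ℕ λ k → Σ (Fin n → Fin k) (IsClassLabelling _∼_)
classLabelling {zero} _ = 0 , (λ ()) , record
  { surjective = λ () ; sound = λ {x} → ⊥-elim (¬Fin0 x) ; complete = λ {x} → ⊥-elim (¬Fin0 x) }
classLabelling {suc n} isDecEq
  with classLabelling (On.isDecEquivalence suc isDecEq) | any? (λ y → IsDecEquivalence._≟_ isDecEq zero (suc y))
... | k , _ , isLabelling | yes (_ , 0∼y) =
  k , _ , ExtendLabelling.joinClass (IsDecEquivalence.isEquivalence isDecEq) isLabelling 0∼y
... | k , _ , isLabelling | no 0≁ =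
  suc k , _ , ExtendLabelling.newClass (IsDecEquivalence.isEquivalence isDecEq) isLabelling
                                       (λ y 0∼y → 0≁ (y , 0∼y))

⟨$⟩ʳ-injective : ∀ {k} (π : Permutation′ k) {i j} → π ⟨$⟩ʳ i ≡ π ⟨$⟩ʳ j → i ≡ j
⟨$⟩ʳ-injective π = Injection.injective (↔⇒↣ π)

relabel : ∀ {n k ℓ} {_∼_ : Rel (Fin n) ℓ} {label : Fin n → Fin k} →
          IsClassLabelling _∼_ label → (π : Permutation′ k) → IsClassLabelling _∼_ ((π ⟨$⟩ʳ_) ∘ label)
relabel isLabelling π .surjective i =
  let x , lx≡π⁻¹i = isLabelling .surjective (π ⟨$⟩ˡ i)
  in  x , trans (cong (π ⟨$⟩ʳ_) lx≡π⁻¹i) (inverseʳ π)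
relabel isLabelling π .sound πlx≡πly = isLabelling .sound (⟨$⟩ʳ-injective π πlx≡πly)
relabel isLabelling π .complete x∼y  = cong (π ⟨$⟩ʳ_) (isLabelling .complete x∼y)

transpose-matchʳ : ∀ {k} (i j : Fin k) → PC.transpose i j j ≡ i
transpose-matchʳ i j with j ≟ i
... | yes j≡i = j≡i
... | no  _ rewrite dec-true (j ≟ j) refl = refl

transpose-fixes : ∀ {k} {i j l : Fin k} → l ≢ i → l ≢ j → PC.transpose i j l ≡ l
transpose-fixes {i = i} {j} {l} l≢i l≢j rewrite dec-false (l ≟ i) l≢i | dec-false (l ≟ j) l≢j = refl

sendToZeroAndOne : ∀ {m} {a b : Fin (suc (suc m))} → a ≢ b →
                   Σ (Permutation′ (suc (suc m))) λ π → π ⟨$⟩ʳ a ≡ zero × π ⟨$⟩ʳ b ≡ suc zero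
sendToZeroAndOne {a = a} {b} a≢b =
  transpose zero a ∘ₚ transpose (suc zero) b′ , a↦0 , transpose-matchʳ (suc zero) b′
  where
  b′ : Fin _
  b′ = PC.transpose zero a b
  b′≢0 : b′ ≢ zero
  b′≢0 b′≡0 = a≢b (⟨$⟩ʳ-injective (transpose zero a) (trans (transpose-matchʳ zero a) (sym b′≡0)))
  a↦0 : PC.transpose (suc zero) b′ (PC.transpose zero a a) ≡ zero
  a↦0 = trans (cong (PC.transpose (suc zero) b′) (transpose-matchʳ zero a))
              (transpose-fixes {i = suc zero} (λ ()) (b′≢0 ∘ sym))

count-mono : ∀ {A : Set} {p q : A → Bool} → (∀ a → T (p a) → T (q a)) → ∀ xs → count p xs ≤ count q xs
count-mono         p⇒q []       = z≤n
count-mono {p = p} {q} p⇒q (a ∷ xs) with p a | q a | p⇒q a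
... | true  | true  | _   = s≤s (count-mono p⇒q xs)
... | true  | false | pa⇒ = ⊥-elim (pa⇒ tt)
... | false | true  | _   = m≤n⇒m≤1+n (count-mono p⇒q xs)
... | false | false | _   = count-mono p⇒q xs

count-cong : ∀ {A : Set} {p q : A → Bool} → (∀ a → p a ≡ q a) → ∀ xs → count p xs ≡ count q xs
count-cong         p≡q []       = refl
count-cong p≡q (a ∷ xs) =
  cong₂ (λ b c → if b then suc c else c) (p≡q a) (count-cong p≡q xs)

count-∧-not : ∀ {A : Set} (p q : A → Bool) xs →
              count (λ a → p a ∧ q a) xs + count (λ a → p a ∧ not (q a)) xs ≡ count p xs
count-∧-not p q []       = refl
count-∧-not p q (a ∷ xs) with p a | q a
... | true  | true  = cong suc (count-∧-not p q xs)
... | true  | false = trans (+-suc _ _) (cong suc (count-∧-not p q xs))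
... | false | _     = count-∧-not p q xs

edgesWhere : ∀ {n} → Graph n → (Fin n → Fin n → Bool) → ℕ
edgesWhere {n} G s = count (λ { (x , y) → (toℕ x <ᵇ toℕ y) ∧ Adj G x y ∧ s x y }) (allPairs n)

edgesWhere-mono : ∀ {n} (G : Graph n) {s t} → (∀ x y → Edge G x y → T (s x y) → T (t x y)) →
                  edgesWhere G s ≤ edgesWhere G t
edgesWhere-mono {n} G {s} {t} s⇒t = count-mono (λ { (x , y) → pointwise x y }) (allPairs n)
  where
  pointwise : ∀ x y → T ((toℕ x <ᵇ toℕ y) ∧ Adj G x y ∧ s x y) →
                      T ((toℕ x <ᵇ toℕ y) ∧ Adj G x y ∧ t x y)
  pointwise x y with toℕ x <ᵇ toℕ y | Adj G x y in xy∈G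
  ... | true  | true  = s⇒t x y xy∈G
  ... | true  | false = λ ()
  ... | false | _     = λ ()

edgesWhere-complement : ∀ {n} (G : Graph n) s → edgesWhere G s + edgesWhere G (λ x y → not (s x y)) ≡ numEdges G
edgesWhere-complement {n} G s = begin
  edgesWhere G s + edgesWhere G (λ x y → not (s x y))
    ≡⟨ cong₂ _+_ (count-cong (λ { (x , y) → reassociate s x y }) (allPairs n))
                 (count-cong (λ { (x , y) → reassociate (λ x y → not (s x y)) x y }) (allPairs n)) ⟩
  count (λ e → isEdge e ∧ separated e) (allPairs n) + count (λ e → isEdge e ∧ not (separated e)) (allPairs n)
    ≡⟨ count-∧-not isEdge separated (allPairs n) ⟩
  numEdges G ∎
  where
  open ≡-Reasoning
  isEdge separated : Fin n × Fin n → Bool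
  isEdge (x , y) = (toℕ x <ᵇ toℕ y) ∧ Adj G x y
  separated (x , y) = s x y
  reassociate : ∀ t x y → (toℕ x <ᵇ toℕ y) ∧ Adj G x y ∧ t x y ≡ isEdge (x , y) ∧ t x y
  reassociate t x y = sym (∧-assoc (toℕ x <ᵇ toℕ y) (Adj G x y) (t x y))

m+n≤o⇒2m≤o⊎2n≤o : ∀ m n {o} → m + n ≤ o → 2 * m ≤ o ⊎ 2 * n ≤ o
m+n≤o⇒2m≤o⊎2n≤o m n m+n≤o with ≤-total m n
... | inj₁ m≤n = inj₁ (≤-trans (+-monoʳ-≤ m (≤-trans (≤-reflexive (ℕₚ.+-identityʳ m)) m≤n)) m+n≤o)
... | inj₂ n≤m = inj₂ (≤-trans (+-monoʳ-≤ n (≤-trans (≤-reflexive (ℕₚ.+-identityʳ n)) n≤m))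
                               (≤-trans (≤-reflexive (ℕₚ.+-comm n m)) m+n≤o))

disjoint⇒one-≤-half : ∀ {n} (G : Graph n) {s t} → (∀ x y → Edge G x y → T (s x y) → ¬ T (t x y)) →
                      2 * edgesWhere G s ≤ numEdges G ⊎ 2 * edgesWhere G t ≤ numEdges G
disjoint⇒one-≤-half G {s} {t} disjoint = m+n≤o⇒2m≤o⊎2n≤o (edgesWhere G s) (edgesWhere G t) (begin
  edgesWhere G s + edgesWhere G t                       ≤⟨ +-monoʳ-≤ (edgesWhere G s) (edgesWhere-mono G t⇒¬s) ⟩
  edgesWhere G s + edgesWhere G (λ x y → not (s x y))   ≡⟨ edgesWhere-complement G s ⟩
  numEdges G                                            ∎)
  where
  open ≤-Reasoning
  t⇒¬s : ∀ x y → Edge G x y → T (t x y) → T (not (s x y))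
  t⇒¬s x y xy∈G txy with s x y in sxy
  ... | true  = disjoint x y xy∈G (subst T (sym sxy) tt) txy
  ... | false = tt

module _ (ℝ : RealField) where
  open RealField ℝ
  open IsStrictTotalOrder isStrictTotalOrder using (compare; asym; irrefl) renaming (_≟_ to _≟ᴿ_; trans to <-trans)

  commutativeRing : CommutativeRing _ _
  commutativeRing = record { isCommutativeRing = isCommutativeRing }

  open CommutativeRing commutativeRing
    using (+-assoc; +-identityˡ; +-identityʳ; -‿inverseʳ; *-identityʳ; *-assoc; distribˡ; distribʳ;
           ring; +-group; +-abelianGroup; +-commutativeSemigroup)
  open import Algebra.Properties.Ring ring using (-‿involutive; -0#≈0#; -1*x≈-x; [y-z]x≈yx-zx)
  open import Algebra.Properties.Group +-group using (⁻¹-injective; x∙y⁻¹≈ε⇒x≈y; //-rightDividesˡ)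
  open import Algebra.Properties.AbelianGroup +-abelianGroup using (⁻¹-∙-comm)
  open import Algebra.Properties.CommutativeSemigroup +-commutativeSemigroup using (interchange)
  open ≡-Reasoning

  x<0⇒0<-x : ∀ {x} → x <ᴿ 0ᴿ → 0ᴿ <ᴿ -ᴿ x
  x<0⇒0<-x {x} x<0 = subst₂ _<ᴿ_ (-‿inverseʳ x) (+-identityˡ (-ᴿ x)) (+-mono-< x 0ᴿ (-ᴿ x) x<0)

  0<x⇒-x<0 : ∀ {x} → 0ᴿ <ᴿ x → -ᴿ x <ᴿ 0ᴿ
  0<x⇒-x<0 {x} 0<x = subst₂ _<ᴿ_ (+-identityˡ (-ᴿ x)) (-‿inverseʳ x) (+-mono-< 0ᴿ x (-ᴿ x) 0<x)

  ∣x∣≡x⊎∣x∣≡-x : ∀ x → ∣ x ∣ᴿ ≡ x ⊎ ∣ x ∣ᴿ ≡ -ᴿ x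
  ∣x∣≡x⊎∣x∣≡-x x with compare x 0ᴿ
  ... | tri< _ _ _ = inj₂ refl
  ... | tri≈ _ _ _ = inj₁ refl
  ... | tri> _ _ _ = inj₁ refl

  x<0⇒∣x∣≡-x : ∀ {x} → x <ᴿ 0ᴿ → ∣ x ∣ᴿ ≡ -ᴿ x
  x<0⇒∣x∣≡-x {x} x<0 with compare x 0ᴿ
  ... | tri< _ _ _   = refl
  ... | tri≈ x≮0 _ _ = ⊥-elim (x≮0 x<0)
  ... | tri> x≮0 _ _ = ⊥-elim (x≮0 x<0)

  x≮0⇒∣x∣≡x : ∀ {x} → ¬ x <ᴿ 0ᴿ → ∣ x ∣ᴿ ≡ x
  x≮0⇒∣x∣≡x {x} x≮0 with compare x 0ᴿ
  ... | tri< x<0 _ _ = ⊥-elim (x≮0 x<0)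
  ... | tri≈ _ _ _   = refl
  ... | tri> _ _ _   = refl

  ∣-x∣≡∣x∣ : ∀ x → ∣ -ᴿ x ∣ᴿ ≡ ∣ x ∣ᴿ
  ∣-x∣≡∣x∣ x with compare x 0ᴿ
  ... | tri< x<0 _ _ = x≮0⇒∣x∣≡x (asym (x<0⇒0<-x x<0))
  ... | tri≈ _ x≡0 _ = trans (x≮0⇒∣x∣≡x (irrefl -x≡0)) (trans -x≡0 (sym x≡0))
    where
    -x≡0 : -ᴿ x ≡ 0ᴿ
    -x≡0 = trans (cong -ᴿ_ x≡0) -0#≈0#
  ... | tri> _ _ 0<x = trans (x<0⇒∣x∣≡-x (0<x⇒-x<0 0<x)) (-‿involutive x)

  infix 4 _≡±_
  _≡±_ : R → R → Set
  x ≡± y = x ≡ y ⊎ x ≡ -ᴿ y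

  ∣x∣≡∣y∣⇒x≡±y : ∀ {x y} → ∣ x ∣ᴿ ≡ ∣ y ∣ᴿ → x ≡± y
  ∣x∣≡∣y∣⇒x≡±y {x} {y} ∣x∣≡∣y∣ with ∣x∣≡x⊎∣x∣≡-x x | ∣x∣≡x⊎∣x∣≡-x y
  ... | inj₁ ∣x∣≡x  | inj₁ ∣y∣≡y  = inj₁ (trans (sym ∣x∣≡x) (trans ∣x∣≡∣y∣ ∣y∣≡y))
  ... | inj₁ ∣x∣≡x  | inj₂ ∣y∣≡-y = inj₂ (trans (sym ∣x∣≡x) (trans ∣x∣≡∣y∣ ∣y∣≡-y))
  ... | inj₂ ∣x∣≡-x | inj₁ ∣y∣≡y  =
    inj₂ (trans (sym (-‿involutive x)) (cong -ᴿ_ (trans (sym ∣x∣≡-x) (trans ∣x∣≡∣y∣ ∣y∣≡y))))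
  ... | inj₂ ∣x∣≡-x | inj₂ ∣y∣≡-y =
    inj₁ (⁻¹-injective (trans (sym ∣x∣≡-x) (trans ∣x∣≡∣y∣ ∣y∣≡-y)))

  -‿≡± : ∀ {x y} → x ≡± y → -ᴿ x ≡± y
  -‿≡± (inj₁ x≡y)  = inj₂ (cong -ᴿ_ x≡y)
  -‿≡± (inj₂ x≡-y) = inj₁ (trans (cong -ᴿ_ x≡-y) (-‿involutive _))

  0<1 : 0ᴿ <ᴿ 1ᴿ
  0<1 with compare 0ᴿ 1ᴿ
  ... | tri< 0<1 _ _ = 0<1
  ... | tri≈ _ 0≡1 _ = ⊥-elim (0≢1 0≡1)
  ... | tri> _ _ 1<0 = ⊥-elim (asym 1<0 (subst (0ᴿ <ᴿ_) -1*-1≡1 (*-pos _ _ 0<-1 0<-1)))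
    where
    0<-1 : 0ᴿ <ᴿ -ᴿ 1ᴿ
    0<-1 = x<0⇒0<-x 1<0
    -1*-1≡1 : -ᴿ 1ᴿ *ᴿ -ᴿ 1ᴿ ≡ 1ᴿ
    -1*-1≡1 = trans (-1*x≈-x (-ᴿ 1ᴿ)) (-‿involutive 1ᴿ)

  2≢0 : ¬ 1ᴿ +ᴿ 1ᴿ ≡ 0ᴿ
  2≢0 2≡0 = irrefl (sym 2≡0) (<-trans 0<1 1<2)
    where
    1<2 : 1ᴿ <ᴿ 1ᴿ +ᴿ 1ᴿ
    1<2 = subst (_<ᴿ 1ᴿ +ᴿ 1ᴿ) (+-identityˡ 1ᴿ) (+-mono-< 0ᴿ 1ᴿ 1ᴿ 0<1)

  ½ : R
  ½ = proj₁ (inverse _ 2≢0)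

  [x+x]*½≡x : ∀ x → (x +ᴿ x) *ᴿ ½ ≡ x
  [x+x]*½≡x x = begin
    (x +ᴿ x) *ᴿ ½              ≡⟨ cong (λ y → (y +ᴿ y) *ᴿ ½) (sym (*-identityʳ x)) ⟩
    (x *ᴿ 1ᴿ +ᴿ x *ᴿ 1ᴿ) *ᴿ ½   ≡⟨ cong (_*ᴿ ½) (sym (distribˡ x 1ᴿ 1ᴿ)) ⟩
    (x *ᴿ (1ᴿ +ᴿ 1ᴿ)) *ᴿ ½      ≡⟨ *-assoc x _ ½ ⟩
    x *ᴿ ((1ᴿ +ᴿ 1ᴿ) *ᴿ ½)      ≡⟨ cong (x *ᴿ_) (proj₂ (inverse _ 2≢0)) ⟩
    x *ᴿ 1ᴿ                    ≡⟨ *-identityʳ x ⟩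
    x                          ∎

  *½-injective : ∀ {x y} → x *ᴿ ½ ≡ y *ᴿ ½ → x ≡ y
  *½-injective {x} {y} x½≡y½ = begin
    x                    ≡⟨ sym ([x+x]*½≡x x) ⟩
    (x +ᴿ x) *ᴿ ½        ≡⟨ distribʳ ½ x x ⟩
    x *ᴿ ½ +ᴿ x *ᴿ ½     ≡⟨ cong₂ _+ᴿ_ x½≡y½ x½≡y½ ⟩
    y *ᴿ ½ +ᴿ y *ᴿ ½     ≡⟨ sym (distribʳ ½ y y) ⟩
    (y +ᴿ y) *ᴿ ½        ≡⟨ [x+x]*½≡x y ⟩
    y                    ∎

  [x-y]+[y-z]≡x-z : ∀ x y z → (x -ᴿ y) +ᴿ (y -ᴿ z) ≡ x -ᴿ z
  [x-y]+[y-z]≡x-z x y z = begin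
    (x -ᴿ y) +ᴿ (y -ᴿ z)          ≡⟨ sym (+-assoc (x -ᴿ y) y (-ᴿ z)) ⟩
    ((x -ᴿ y) +ᴿ y) -ᴿ z          ≡⟨ cong (_-ᴿ z) (//-rightDividesˡ y x) ⟩
    x -ᴿ z                        ∎

  [x-y]-[z-w]≡[x-z]-[y-w] : ∀ x y z w → (x -ᴿ y) -ᴿ (z -ᴿ w) ≡ (x -ᴿ z) -ᴿ (y -ᴿ w)
  [x-y]-[z-w]≡[x-z]-[y-w] x y z w = begin
    (x -ᴿ y) -ᴿ (z -ᴿ w)             ≡⟨ cong ((x -ᴿ y) +ᴿ_) (sym (⁻¹-∙-comm z (-ᴿ w))) ⟩
    (x -ᴿ y) +ᴿ (-ᴿ z -ᴿ -ᴿ w)       ≡⟨ interchange x (-ᴿ y) (-ᴿ z) (-ᴿ (-ᴿ w)) ⟩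
    (x -ᴿ z) +ᴿ (-ᴿ y -ᴿ -ᴿ w)       ≡⟨ cong ((x -ᴿ z) +ᴿ_) (⁻¹-∙-comm y (-ᴿ w)) ⟩
    (x -ᴿ z) -ᴿ (y -ᴿ w)             ∎

  x-y≡z-w⇒x-z≡y-w : ∀ {x y z w} → x -ᴿ y ≡ z -ᴿ w → x -ᴿ z ≡ y -ᴿ w
  x-y≡z-w⇒x-z≡y-w {x} {y} {z} {w} x-y≡z-w = x∙y⁻¹≈ε⇒x≈y _ _ (begin
    (x -ᴿ z) -ᴿ (y -ᴿ w)     ≡⟨ [x-y]-[z-w]≡[x-z]-[y-w] x z y w ⟩
    (x -ᴿ y) -ᴿ (z -ᴿ w)     ≡⟨ cong (_-ᴿ (z -ᴿ w)) x-y≡z-w ⟩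
    (z -ᴿ w) -ᴿ (z -ᴿ w)     ≡⟨ -‿inverseʳ (z -ᴿ w) ⟩
    0ᴿ                       ∎)

  consecSum-differences : ∀ {A : Set} (ψ : A → R) x ys z →
                          consecSum ℝ (λ a b → ψ a -ᴿ ψ b) (x ∷ ys ++ [ z ]) ≡ ψ x -ᴿ ψ z
  consecSum-differences ψ x []       z = +-identityʳ (ψ x -ᴿ ψ z)
  consecSum-differences ψ x (y ∷ ys) z =
    trans (cong ((ψ x -ᴿ ψ y) +ᴿ_) (consecSum-differences ψ y ys z)) ([x-y]+[y-z]≡x-z (ψ x) (ψ y) (ψ z))

  consecSum-closeUp-differences : ∀ {n} (ψ : Fin n → R) xs →
                                  consecSum ℝ (λ a b → ψ a -ᴿ ψ b) (closeUp xs) ≡ 0ᴿ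
  consecSum-closeUp-differences ψ []       = refl
  consecSum-closeUp-differences ψ (x ∷ xs) = trans (consecSum-differences ψ x xs x) (-‿inverseʳ (ψ x))

  potential : ∀ {A : Set} → (A → R) → (A → R) → A → R
  potential f g x = (f x -ᴿ g x) *ᴿ ½

  module _ {A : Set} (f g : A → R) {x y : A} where

    potential-level : f x -ᴿ f y ≡ g x -ᴿ g y → potential f g x ≡ potential f g y
    potential-level = cong (_*ᴿ ½) ∘ x-y≡z-w⇒x-z≡y-w

    potential-level⁻¹ : potential f g x ≡ potential f g y → f x -ᴿ f y ≡ g x -ᴿ g y
    potential-level⁻¹ = x-y≡z-w⇒x-z≡y-w ∘ *½-injective

    potential-jump : g x -ᴿ g y ≡ -ᴿ (f x -ᴿ f y) → f x -ᴿ f y ≡ potential f g x -ᴿ potential f g y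
    potential-jump Δg≡-Δf = sym (begin
      (f x -ᴿ g x) *ᴿ ½ -ᴿ (f y -ᴿ g y) *ᴿ ½   ≡⟨ sym ([y-z]x≈yx-zx ½ _ _) ⟩
      ((f x -ᴿ g x) -ᴿ (f y -ᴿ g y)) *ᴿ ½      ≡⟨ cong (_*ᴿ ½) ([x-y]-[z-w]≡[x-z]-[y-w] _ _ _ _) ⟩
      ((f x -ᴿ f y) -ᴿ (g x -ᴿ g y)) *ᴿ ½      ≡⟨ cong (λ z → ((f x -ᴿ f y) -ᴿ z) *ᴿ ½) Δg≡-Δf ⟩
      ((f x -ᴿ f y) -ᴿ -ᴿ (f x -ᴿ f y)) *ᴿ ½   ≡⟨ cong (λ z → ((f x -ᴿ f y) +ᴿ z) *ᴿ ½) (-‿involutive _) ⟩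
      ((f x -ᴿ f y) +ᴿ (f x -ᴿ f y)) *ᴿ ½      ≡⟨ [x+x]*½≡x _ ⟩
      f x -ᴿ f y                               ∎)

  separates : ∀ {A : Set} → (A → R) → A → A → Bool
  separates φ x y = not ⌊ φ x ≟ᴿ φ y ⌋

  IsJumpPotential : ∀ {n} → Graph n → (Fin n → R) → (Fin n → R) → Set
  IsJumpPotential G f φ = ∀ x y → Edge G x y → φ x ≡ φ y ⊎ f x -ᴿ f y ≡ φ x -ᴿ φ y

  reflectionPotential : ∀ {n} (G : Graph n) {f g : Fin n → R} {u v} →
    (∀ x y → Edge G x y → ∣ g x -ᴿ g y ∣ᴿ ≡ ∣ f x -ᴿ f y ∣ᴿ) → ¬ ∣ f u -ᴿ f v ∣ᴿ ≡ ∣ g u -ᴿ g v ∣ᴿ →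
    Σ (Fin n → R) λ φ → IsJumpPotential G f φ × ¬ φ u ≡ φ v × 2 * edgesWhere G (separates φ) ≤ numEdges G
  reflectionPotential {n} G {f} {g} {u} {v} ∣Δg∣≡∣Δf∣ ∣Δf∣≢∣Δg∣ =
    Sum.[ (λ few → potential f g  , isJumpPotential g Δg≡±Δf  , u≁v  , few)
        , (λ few → potential f -g , isJumpPotential -g Δ-g≡±Δf , u≁v⁻ , few)
        ] (disjoint⇒one-≤-half G disjoint)
    where
    -g : Fin n → R
    -g x = -ᴿ g x

    -g-sub : ∀ x y → -g x -ᴿ -g y ≡ -ᴿ (g x -ᴿ g y)
    -g-sub x y = ⁻¹-∙-comm (g x) (-ᴿ g y)

    Δg≡±Δf : ∀ x y → Edge G x y → g x -ᴿ g y ≡± f x -ᴿ f y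
    Δg≡±Δf x y xy∈G = ∣x∣≡∣y∣⇒x≡±y (∣Δg∣≡∣Δf∣ x y xy∈G)

    Δ-g≡±Δf : ∀ x y → Edge G x y → -g x -ᴿ -g y ≡± f x -ᴿ f y
    Δ-g≡±Δf x y xy∈G = subst (_≡± f x -ᴿ f y) (sym (-g-sub x y)) (-‿≡± (Δg≡±Δf x y xy∈G))

    isJumpPotential : ∀ h → (∀ x y → Edge G x y → h x -ᴿ h y ≡± f x -ᴿ f y) →
                      IsJumpPotential G f (potential f h)
    isJumpPotential h Δh≡±Δf x y xy∈G =
      Sum.map (potential-level f h ∘ sym) (potential-jump f h) (Δh≡±Δf x y xy∈G)

    disjoint : ∀ x y → Edge G x y → T (separates (potential f g) x y) → ¬ T (separates (potential f -g) x y)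
    disjoint x y xy∈G sep sep⁻ with Δ-g≡±Δf x y xy∈G
    ... | inj₁ Δ-g≡Δf  = toWitnessFalse sep⁻ (potential-level f -g (sym Δ-g≡Δf))
    ... | inj₂ Δ-g≡-Δf =
      toWitnessFalse sep (potential-level f g (sym (⁻¹-injective (trans (sym (-g-sub x y)) Δ-g≡-Δf))))

    u≁v : ¬ potential f g u ≡ potential f g v
    u≁v = ∣Δf∣≢∣Δg∣ ∘ cong ∣_∣ᴿ ∘ potential-level⁻¹ f g

    u≁v⁻ : ¬ potential f -g u ≡ potential f -g v
    u≁v⁻ φu≡φv = ∣Δf∣≢∣Δg∣ (begin
      ∣ f u -ᴿ f v ∣ᴿ             ≡⟨ cong ∣_∣ᴿ (trans (potential-level⁻¹ f -g φu≡φv) (-g-sub u v)) ⟩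
      ∣ -ᴿ (g u -ᴿ g v) ∣ᴿ        ≡⟨ ∣-x∣≡∣x∣ (g u -ᴿ g v) ⟩
      ∣ g u -ᴿ g v ∣ᴿ             ∎)

  SeparatingWitness : ∀ {n} → Graph n → (Fin n → R) → Fin n → Fin n → Set
  SeparatingWitness {n} G f u v =
    Σ ℕ λ m → Σ (Fin n → Fin (suc (suc m))) λ part →
      IsWitness ℝ G f part × part u ≡ zero × part v ≡ suc zero

  module JumpPotentialWitness {n} {G : Graph n} {f φ : Fin n → R} (jump : IsJumpPotential G f φ) where

    LevelEdge : Rel (Fin n) 0ℓ
    LevelEdge x y = Edge G x y × φ x ≡ φ y

    levelEdge-sym : Symmetric LevelEdge
    levelEdge-sym {x} {y} (xy∈G , φx≡φy) = trans (Graph.sym G y x) xy∈G , sym φx≡φy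

    star-isDecEquivalence : IsDecEquivalence (Star LevelEdge)
    star-isDecEquivalence = record
      { isEquivalence = record { refl = ε ; sym = reverse levelEdge-sym ; trans = _◅◅_ }
      ; _≟_           = star-decidable levelEdge-sym (λ x y → (Adj G x y ≟ᴮ true) ×-dec (φ x ≟ᴿ φ y))
      }

    φ-constant : ∀ {x y} → Star LevelEdge x y → φ x ≡ φ y
    φ-constant ε                    = refl
    φ-constant ((_ , φx≡φy) ◅ y⇝z) = trans φx≡φy (φ-constant y⇝z)

    module _ {k} {part : Fin n → Fin k} (isLabelling : IsClassLabelling (Star LevelEdge) part) where
      private module L = IsClassLabelling isLabelling

      height : Fin k → R
      height i = φ (proj₁ (L.surjective i))

      height-part : ∀ x → height (part x) ≡ φ x
      height-part x = φ-constant (L.sound (proj₂ (L.surjective (part x))))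

      isWitness : 2 * edgesWhere G (separates φ) ≤ numEdges G → IsWitness ℝ G f part
      isWitness few =
        (L.surjective , connected) , (λ i j → height i -ᴿ height j) , (λ i → -‿inverseʳ (height i)) ,
        crossing-few , crossing-jump , (λ xs _ → consecSum-closeUp-differences (height ∘ part) xs)
        where
        connected : ∀ i → InducedConnected G (λ x → part x ≡ i)
        connected i x y px≡i py≡i =
          star⇒walkIn proj₁ (λ a~b pa≡i → trans (sym (L.complete (return a~b))) pa≡i)
                      (L.sound (trans px≡i (sym py≡i))) px≡i

        crossing-few : 2 * numCrossEdges G part ≤ numEdges G
        crossing-few = ≤-trans (*-monoʳ-≤ 2 (edgesWhere-mono G crossing⇒separated)) few
          where
          crossing⇒separated : ∀ x y → Edge G x y → T (not ⌊ part x ≟ part y ⌋) → T (separates φ x y)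
          crossing⇒separated x y xy∈G crossing =
            fromWitnessFalse (λ φx≡φy → toWitnessFalse crossing (L.complete (return (xy∈G , φx≡φy))))

        crossing-jump : ∀ a b → ¬ part a ≡ part b → Edge G a b →
                        f a -ᴿ f b ≡ height (part a) -ᴿ height (part b)
        crossing-jump a b pa≢pb ab∈G with jump a b ab∈G
        ... | inj₁ φa≡φb       = ⊥-elim (pa≢pb (L.complete (return (ab∈G , φa≡φb))))
        ... | inj₂ fa-fb≡φa-φb = trans fa-fb≡φa-φb (sym (cong₂ _-ᴿ_ (height-part a) (height-part b)))

    witness : ∀ {u v} → ¬ φ u ≡ φ v → 2 * edgesWhere G (separates φ) ≤ numEdges G →
              SeparatingWitness G f u v
    witness {u} {v} φu≢φv few = fromLabelling (proj₂ (proj₂ (classLabelling star-isDecEquivalence)))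
      where
      Fin1-irrelevant : (i j : Fin 1) → i ≡ j
      Fin1-irrelevant zero zero = refl

      fromLabelling : ∀ {k} {part : Fin n → Fin k} → IsClassLabelling (Star LevelEdge) part →
                      SeparatingWitness G f u v
      fromLabelling {zero}        {part} _           = ⊥-elim (¬Fin0 (part u))
      fromLabelling {suc zero}    {part} isLabelling =
        ⊥-elim (φu≢φv (φ-constant (isLabelling .sound (Fin1-irrelevant (part u) (part v)))))
      fromLabelling {suc (suc m)} {part} isLabelling
        with sendToZeroAndOne (λ pu≡pv → φu≢φv (φ-constant (isLabelling .sound pu≡pv)))
      ... | π , πu≡0 , πv≡1 =
        m , (π ⟨$⟩ʳ_) ∘ part , isWitness (relabel isLabelling π) few , πu≡0 , πv≡1

lemma3p3 : (ℝ : RealField) (n : ℕ) (f : Fin n → RealField.R ℝ) →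
           Injective _≡_ _≡_ f →
           (G : Graph n) → Connected G →
           (u v : Fin n) → NotReconstructible ℝ G f u v →
           Σ ℕ λ m → Σ (Fin n → Fin (suc (suc m))) λ part →
             IsWitness ℝ G f part × part u ≡ zero × part v ≡ suc zero
lemma3p3 ℝ n f _ G _ u v (g , _ , ∣Δg∣≡∣Δf∣ , ∣Δf∣≢∣Δg∣) =
  let φ , jump , φu≢φv , few = reflectionPotential ℝ G ∣Δg∣≡∣Δf∣ ∣Δf∣≢∣Δg∣
  in  JumpPotentialWitness.witness ℝ jump φu≢φv few
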